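{- Let $d\in\mathbb N$, let $\mathcal{D}_d$ be the class of finite graphs with maximum degree at most $d$, and let $\tau$ be an FO transduction. Then there exist integers $\ell$ and $q$, depending only on $d$ and $\tau$, such that every graph $H\in\tau(\mathcal{D}_d)$ is $(\ell,q)$-near-covered.
   Context: Graphs are finite, simple and undirected. FO logic is first-order logic over relational structures (vertex variables, equality, the relations of the structure, Boolean connectives, vertex quantifiers). A basic FO transduction $\tau_0$ is a triple $(\chi,\nu,\mu)$ of FO formulas with $0$, $1$ and $2$ free variables (with $\mu$ defining a symmetric irreflexive relation); it maps a structure $G$ to the graph with vertex set $\{v\mid G\models\nu(v)\}$ and edge set $\{\{u,v\}\mid G\models\mu(u,v)\}$ restricted to these vertices, and is undefined if $G\not\models\chi$. The $m$-copy operation maps a graph $G$ to $G^m$ with vertex set $V(G)\times\{1,\dots,m\}$, where each $V(G)\times\{i\}$ induces a copy of $G$, there are no edges between distinct copies, and $G^m$ is equipped with a binary relation $\sim$ with $(u,i)\sim(v,j)$ iff $u=v$, and unary relations $Q_i=\{(v,i)\mid v\in V(G)\}$. The $p$-parameter expansion maps $G$ to the set of all structures obtained by adding $p$ arbitrary unary predicates on $V(G)$. An FO transduction is a many-valued map $\tau=\tau_0\circ\gamma\circ\varepsilon$ with $\tau_0$ a basic FO transduction (whose formulas may use $\sim$ and $Q_i$), $\gamma$ an $m$-copy operation and $\varepsilon$ a $p$-parameter expansion, for some $m,p$; for a class $\mathcal{C}$, $\tau(\mathcal{C})=\bigcup_{G\in\mathcal{C}}\tau(G)$. For $v$ in a graph,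 $N(v)$ is its neighbour set; $u,v$ are near-$\ell$-twins if $|N(u)\mathop{\bigtriangleup} N(v)|\le\ell$. A graph $H$ is $(\ell,q)$-near-covered if there exist vertices $v_1,\dots,v_q\in V(H)$ such that every vertex of $H$ is a near-$\ell$-twin of at least one of them. -}

module Defs where

open import Data.Nat using (ℕ; zero; suc; _+_; _*_; _≤_)
open import Data.Bool using (Bool; true; false; _∧_; _∨_; not; _xor_; if_then_else_)
open import Data.Fin using (Fin; zero; suc; remQuot; _≟_)
open import Data.Product using (Σ; _×_; _,_; proj₁; proj₂; ∃-syntax)
open import Data.List using (List; length)
open import Data.List.Relation.Unary.All using (All)
open import Data.List.Relation.Unary.Any using (Any)
open import Relation.Binary.PropositionalEquality using (_≡_)
open import Relation.Nullary.Decidable using (⌊_⌋)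

anyFin : (n : ℕ) → (Fin n → Bool) → Bool
anyFin zero    f = false
anyFin (suc n) f = f zero ∨ anyFin n (λ i → f (suc i))

allFin : (n : ℕ) → (Fin n → Bool) → Bool
allFin zero    f = true
allFin (suc n) f = f zero ∧ allFin n (λ i → f (suc i))

countFin : (n : ℕ) → (Fin n → Bool) → ℕ
countFin zero    f = 0
countFin (suc n) f = (if f zero then 1 else 0) + countFin n (λ i → f (suc i))

_=ᶠ_ : {n : ℕ} → Fin n → Fin n → Bool
i =ᶠ j = ⌊ i ≟ j ⌋

record Graph : Set where
  field
    n       : ℕ
    adj     : Fin n → Fin n → Bool
    sym     : ∀ u v → adj u v ≡ adj v u
    irrefl  : ∀ v → adj v v ≡ false

open Graph public

degree : (G : Graph) → Fin (n G) → ℕ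
degree G v = countFin (n G) (adj G v)

MaxDegree≤ : ℕ → Graph → Set
MaxDegree≤ d G = ∀ v → degree G v ≤ d

symDiffIn : (G : Graph) → (Fin (n G) → Bool) → Fin (n G) → Fin (n G) → ℕ
symDiffIn G S u v = countFin (n G) (λ w → S w ∧ (adj G u w xor adj G v w))

NearTwinIn : ℕ → (G : Graph) → (Fin (n G) → Bool) → Fin (n G) → Fin (n G) → Set
NearTwinIn ℓ G S u v = symDiffIn G S u v ≤ ℓ

NearCoveredIn : ℕ → ℕ → (G : Graph) → (Fin (n G) → Bool) → Set
NearCoveredIn ℓ q G S =
  Σ (List (Fin (n G))) λ vs →
    (length vs ≤ q) ×
    All (λ v → S v ≡ true) vs ×
    (∀ u → S u ≡ true → Any (λ v → NearTwinIn ℓ G S u v) vs)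

-- FO logic over the vocabulary of p-parameter-expanded m-copies:
-- binary E (edge) and ∼, unary Q_i (i < m) and P_j (j < p).
-- Variables are de Bruijn indices Fin k.

data Formula (m p : ℕ) : ℕ → Set where
  tt ff : ∀ {k} → Formula m p k
  eq   : ∀ {k} → Fin k → Fin k → Formula m p k
  E    : ∀ {k} → Fin k → Fin k → Formula m p k
  sim  : ∀ {k} → Fin k → Fin k → Formula m p k
  Q    : ∀ {k} → Fin m → Fin k → Formula m p k
  P    : ∀ {k} → Fin p → Fin k → Formula m p k
  neg  : ∀ {k} → Formula m p k → Formula m p k
  and  : ∀ {k} → Formula m p k → Formula m p k → Formula m p k
  or   : ∀ {k} → Formula m p k → Formula m p k → Formula m p k
  ex   : ∀ {k} → Formula m p (suc k) → Formula m p k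
  fa   : ∀ {k} → Formula m p (suc k) → Formula m p k

record Structure (m p : ℕ) : Set where
  field
    size  : ℕ
    relE  : Fin size → Fin size → Bool
    rel∼  : Fin size → Fin size → Bool
    relQ  : Fin m → Fin size → Bool
    relP  : Fin p → Fin size → Bool

open Structure public

extend : ∀ {k N} → (Fin k → Fin N) → Fin N → Fin (suc k) → Fin N
extend σ a zero    = a
extend σ a (suc i) = σ i

eval : ∀ {m p k} (S : Structure m p) → Formula m p k → (Fin k → Fin (size S)) → Bool
eval S tt        σ = true
eval S ff        σ = false
eval S (eq x y)  σ = σ x =ᶠ σ y
eval S (E x y)   σ = relE S (σ x) (σ y)
eval S (sim x y) σ = rel∼ S (σ x) (σ y)
eval S (Q i x)   σ = relQ S i (σ x)
eval S (P j x)   σ = relP S j (σ x)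
eval S (neg φ)   σ = not (eval S φ σ)
eval S (and φ ψ) σ = eval S φ σ ∧ eval S ψ σ
eval S (or φ ψ)  σ = eval S φ σ ∨ eval S ψ σ
eval S (ex φ)    σ = anyFin (size S) (λ a → eval S φ (extend σ a))
eval S (fa φ)    σ = allFin (size S) (λ a → eval S φ (extend σ a))

σ₀ : ∀ {N} → Fin 0 → Fin N
σ₀ ()

σ₁ : ∀ {N} → Fin N → Fin 1 → Fin N
σ₁ a zero = a

σ₂ : ∀ {N} → Fin N → Fin N → Fin 2 → Fin N
σ₂ a b zero       = a
σ₂ a b (suc zero) = b

-- γ ∘ ε : the m-copy of the p-parameter expansion (G, params).
-- The element (v , i) ∈ V(G) × {1..m} is encoded in Fin (n G * m)
-- via Data.Fin.combine / remQuot.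

copyExpand : (m p : ℕ) (G : Graph) → (Fin p → Fin (n G) → Bool) → Structure m p
copyExpand m p G params = record
  { size = n G * m
  ; relE = λ x y → let (u , i) = remQuot m x ; (v , j) = remQuot m y
                   in (i =ᶠ j) ∧ adj G u v
  ; rel∼ = λ x y → proj₁ (remQuot {n G} m x) =ᶠ proj₁ (remQuot {n G} m y)
  ; relQ = λ i x → proj₂ (remQuot {n G} m x) =ᶠ i
  ; relP = λ j x → params j (proj₁ (remQuot {n G} m x))
  }

-- FO transductions τ = τ₀ ∘ γ ∘ ε

record Transduction : Set where
  field
    copies : ℕ
    params : ℕ
    χ : Formula copies params 0
    ν : Formula copies params 1
    μ : Formula copies params 2
    μ-sym    : ∀ (S : Structure copies params) a b →
               eval S μ (σ₂ a b) ≡ eval S μ (σ₂ b a)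
    μ-irrefl : ∀ (S : Structure copies params) a →
               eval S μ (σ₂ a a) ≡ false

open Transduction public

-- the graph on all elements of S with adjacency μ (H is its induced
-- subgraph on the ν-elements)
μGraph : (τ : Transduction) → Structure (copies τ) (params τ) → Graph
μGraph τ S = record
  { n      = size S
  ; adj    = λ a b → eval S (μ τ) (σ₂ a b)
  ; sym    = μ-sym τ S
  ; irrefl = μ-irrefl τ S
  }

-- Every graph H ∈ τ(G) is (ℓ,q)-near-covered, where H ranges over the
-- outputs τ₀(S) for S ∈ γ(ε(G)) with S ⊨ χ.
AllOutputsNearCovered : ℕ → ℕ → Transduction → Graph → Set
AllOutputsNearCovered ℓ q τ G =
  ∀ (ps : Fin (params τ) → Fin (n G) → Bool) →
  let S = copyExpand (copies τ) (params τ) G ps in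
  eval S (χ τ) σ₀ ≡ true →
  NearCoveredIn ℓ q (μGraph τ S) (λ a → eval S (ν τ) (σ₁ a))

-- Locality: if the r-neighbourhoods of two tuples of a finite structure are isomorphic, where r is
-- the radius of φ (growing as 3r+1 per quantifier), then φ does not distinguish them. In the m-copy of a
-- graph of maximum degree d, balls of radius R have at most M elements, so the R-neighbourhoods of
-- single elements fall into at most 2^L isomorphism types. If u and x have the same type, then
-- μ(u,w) = μ(x,w) for every w at distance more than 2R+1 from both, so |N(u) △ N(x)| is at most the
-- size of two (2R+1)-balls; one representative per type gives the near-cover.
module Submission where

open import Defs
open import Data.Bool using (Bool; true; false; _∧_; _∨_; not; _xor_; if_then_else_)
import Data.Bool as Bool
open import Data.Bool.Properties using (∨-comm; ∨-zeroʳ; ∨-conicalˡ; ∨-conicalʳ; ∧-conicalˡ; ∧-conicalʳ; ¬-not; not-¬; xor-same)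
open import Data.Empty using (⊥; ⊥-elim)
open import Data.Fin using (Fin; zero; suc; toℕ; fromℕ<; _↑ˡ_; _↑ʳ_; quotient; remQuot; combine; _≟_)
open import Data.Fin.Properties using (any?; all?; 0≢1+n; suc-injective; toℕ-fromℕ<; splitAt-↑ˡ; splitAt-↑ʳ; remQuot-combine)
open import Data.List using (List; []; _∷_; length; _++_; map; mapMaybe)
open import Data.List.Properties using (length-++; length-map; length-mapMaybe)
open import Data.List.Relation.Unary.All as All using (All)
import Data.List.Relation.Unary.All.Properties as Allₚ
open import Data.List.Relation.Unary.Any as Any using (Any; here)
import Data.List.Relation.Unary.Any.Properties as Anyₚ
open import Data.Maybe using (Maybe; just; nothing; is-just; fromMaybe)
import Data.Maybe as Maybe
open import Data.Maybe.Properties using (map-just)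
import Data.Maybe.Relation.Unary.Any as MAny
open import Data.Nat using (ℕ; zero; suc; _+_; _*_; _^_; _≤_; _<_; z≤n; s≤s; _⊔_; _≤′_; ≤′-refl; ≤′-step)
open import Data.Nat.Properties hiding (_≟_; suc-injective; 0≢1+n)
open import Data.Product using (∃-syntax; _×_; _,_; proj₁; proj₂; uncurry)
open import Data.Sum using (_⊎_; inj₁; inj₂)
open import Data.Vec.Functional using (Vector) renaming (_∷_ to _∷ᵛ_; _++_ to _++ᵛ_)
open import Data.Vec.Functional.Properties using (++-injective)
open import Function using (_∘_; mk⇔)
open import Relation.Binary.PropositionalEquality
  using (_≡_; _≢_; _≗_; refl; trans; cong; cong₂; subst; module ≡-Reasoning)
  renaming (sym to ≡-sym)
open import Relation.Nullary using (¬_; Dec; yes; no; does)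
open import Relation.Nullary.Decidable.Core using (¬¬-excluded-middle; dec⇒maybe; _×-dec_)
open import Relation.Nullary.Decidable using (isYes; isYes≗does; dec-true; does-⇔; decidable-stable)

∨-introˡ : ∀ {a} b → a ≡ true → a ∨ b ≡ true
∨-introˡ b refl = refl

∨-introʳ : ∀ a {b} → b ≡ true → a ∨ b ≡ true
∨-introʳ a refl = ∨-zeroʳ a

∨-elim : ∀ a b → a ∨ b ≡ true → a ≡ true ⊎ b ≡ true
∨-elim true  b _ = inj₁ refl
∨-elim false b p = inj₂ p

∧-intro : ∀ {a b} → a ≡ true → b ≡ true → a ∧ b ≡ true
∧-intro refl refl = refl

true≢false : ∀ {b} → b ≡ true → b ≢ false
true≢false = not-¬

≡-fromTrue⇔ : ∀ {a b} → (a ≡ true → b ≡ true) → (b ≡ true → a ≡ true) → a ≡ b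
≡-fromTrue⇔ {true}  f g = ≡-sym (f refl)
≡-fromTrue⇔ {false} {true}  f g = g refl
≡-fromTrue⇔ {false} {false} f g = refl

=ᶠ-refl : ∀ {n} (i : Fin n) → (i =ᶠ i) ≡ true
=ᶠ-refl i = trans (isYes≗does (i ≟ i)) (dec-true (i ≟ i) refl)

=ᶠ⇒≡ : ∀ {n} (i j : Fin n) → (i =ᶠ j) ≡ true → i ≡ j
=ᶠ⇒≡ i j p with i ≟ j
... | yes i≡j = i≡j

=ᶠ-sym : ∀ {n} (i j : Fin n) → (i =ᶠ j) ≡ (j =ᶠ i)
=ᶠ-sym i j = begin
  isYes (i ≟ j) ≡⟨ isYes≗does (i ≟ j) ⟩
  does (i ≟ j)  ≡⟨ does-⇔ (mk⇔ ≡-sym ≡-sym) (i ≟ j) (j ≟ i) ⟩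
  does (j ≟ i)  ≡⟨ isYes≗does (j ≟ i) ⟨
  isYes (j ≟ i) ∎
  where open ≡-Reasoning

anyFin-intro : ∀ n (f : Fin n → Bool) i → f i ≡ true → anyFin n f ≡ true
anyFin-intro (suc n) f zero    p = ∨-introˡ _ p
anyFin-intro (suc n) f (suc i) p = ∨-introʳ (f zero) (anyFin-intro n (f ∘ suc) i p)

anyFin-elim : ∀ n (f : Fin n → Bool) → anyFin n f ≡ true → ∃[ i ] f i ≡ true
anyFin-elim (suc n) f p with ∨-elim (f zero) _ p
... | inj₁ q = zero , q
... | inj₂ q with anyFin-elim n (f ∘ suc) q
... | i , r = suc i , r

allFin-intro : ∀ n (f : Fin n → Bool) → (∀ i → f i ≡ true) → allFin n f ≡ true
allFin-intro zero    f h = refl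
allFin-intro (suc n) f h = ∧-intro (h zero) (allFin-intro n (f ∘ suc) (h ∘ suc))

allFin-elim : ∀ n (f : Fin n → Bool) → allFin n f ≡ true → ∀ i → f i ≡ true
allFin-elim (suc n) f p zero    = ∧-conicalˡ (f zero) _ p
allFin-elim (suc n) f p (suc i) = allFin-elim n (f ∘ suc) (∧-conicalʳ (f zero) _ p) i

countFin-cong : ∀ n {f g : Fin n → Bool} → (∀ i → f i ≡ g i) → countFin n f ≡ countFin n g
countFin-cong zero    h = refl
countFin-cong (suc n) h = cong₂ (λ b c → (if b then 1 else 0) + c) (h zero) (countFin-cong n (h ∘ suc))

countFin-mono : ∀ n {f g : Fin n → Bool} → (∀ i → f i ≡ true → g i ≡ true) → countFin n f ≤ countFin n g
countFin-mono zero    h = z≤n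
countFin-mono (suc n) {f} {g} h = +-mono-≤ (head (f zero) (g zero) (h zero)) (countFin-mono n (h ∘ suc))
  where
  head : ∀ a b → (a ≡ true → b ≡ true) → (if a then 1 else 0) ≤ (if b then 1 else 0)
  head true  b a⇒b rewrite a⇒b refl = ≤-refl
  head false b a⇒b = z≤n

countFin-false : ∀ n {f : Fin n → Bool} → (∀ i → f i ≡ false) → countFin n f ≡ 0
countFin-false zero    h = refl
countFin-false (suc n) h rewrite h zero = countFin-false n (h ∘ suc)

countFin-∨ : ∀ n (f g : Fin n → Bool) → countFin n (λ i → f i ∨ g i) ≤ countFin n f + countFin n g
countFin-∨ zero    f g = z≤n
countFin-∨ (suc n) f g with f zero | g zero
... | false | false = countFin-∨ n (f ∘ suc) (g ∘ suc)
... | false | true  = ≤-trans (s≤s (countFin-∨ n (f ∘ suc) (g ∘ suc))) (≤-reflexive (≡-sym (+-suc _ _)))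
... | true  | b     = s≤s (≤-trans (countFin-∨ n (f ∘ suc) (g ∘ suc))
                              (+-monoʳ-≤ (countFin n (f ∘ suc)) (m≤n+m (countFin n (g ∘ suc)) (if b then 1 else 0))))

countFin-witness : ∀ n (f : Fin n → Bool) i → f i ≡ true → 1 ≤ countFin n f
countFin-witness (suc n) f zero    p rewrite p = s≤s z≤n
countFin-witness (suc n) f (suc i) p = ≤-trans (countFin-witness n (f ∘ suc) i p) (m≤n+m _ _)

countFin-≤1 : ∀ n (f : Fin n → Bool) → (∀ i j → f i ≡ true → f j ≡ true → i ≡ j) → countFin n f ≤ 1
countFin-≤1 zero    f h = z≤n
countFin-≤1 (suc n) f h with f zero in f0
... | true  = ≤-reflexive (cong suc (countFin-false n (λ i → ¬-not (λ fi → 0≢1+n (h zero (suc i) f0 fi)))))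
... | false = countFin-≤1 n (f ∘ suc) (λ i j p q → suc-injective (h (suc i) (suc j) p q))

countFin-split : ∀ n (f g : Fin n → Bool) →
  countFin n f ≡ countFin n (λ i → f i ∧ g i) + countFin n (λ i → f i ∧ not (g i))
countFin-split zero    f g = refl
countFin-split (suc n) f g with f zero | g zero
... | false | _     = countFin-split n (f ∘ suc) (g ∘ suc)
... | true  | true  = cong suc (countFin-split n (f ∘ suc) (g ∘ suc))
... | true  | false = trans (cong suc (countFin-split n (f ∘ suc) (g ∘ suc))) (≡-sym (+-suc _ _))

countFin-⊈ : ∀ N (T A B : Fin N → Bool) a → T a ≡ true → A a ≡ false →
  countFin N (λ x → T x ∧ B x) ≤ countFin N (λ x → T x ∧ A x) → ¬ (∀ x → T x ≡ true → B x ≡ true)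
countFin-⊈ N T A B a Ta Aa TB≤TA T⊆B = <-irrefl refl (begin-strict
  countFin N (λ x → T x ∧ A x)                                  <⟨ m<m+n _ T∖A-nonempty ⟩
  countFin N (λ x → T x ∧ A x) + countFin N (λ x → T x ∧ not (A x)) ≡⟨ countFin-split N T A ⟨
  countFin N T                                                  ≤⟨ countFin-mono N (λ x t → ∧-intro t (T⊆B x t)) ⟩
  countFin N (λ x → T x ∧ B x)                                  ≤⟨ TB≤TA ⟩
  countFin N (λ x → T x ∧ A x)                                  ∎)
  where
  open ≤-Reasoning
  T∖A-nonempty : 0 < countFin N (λ x → T x ∧ not (A x))
  T∖A-nonempty = countFin-witness N _ a (∧-intro Ta (cong not Aa))

countFin-single : ∀ N (B : Fin N → Bool) x → B x ≡ true → countFin N (λ y → B y ∧ (x =ᶠ y)) ≡ 1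
countFin-single N B x Bx = ≤-antisym
  (countFin-≤1 N _ (λ i j p q → trans (≡-sym (=ᶠ⇒≡ x i (∧-conicalʳ _ _ p))) (=ᶠ⇒≡ x j (∧-conicalʳ _ _ q))))
  (countFin-witness N _ x (∧-intro Bx (=ᶠ-refl x)))

countFin-injection : ∀ n {N} (A : Fin n → Bool) (B : Fin N → Bool) (h : Fin n → Fin N) →
  (∀ x → A x ≡ true → B (h x) ≡ true) →
  (∀ x y → A x ≡ true → A y ≡ true → h x ≡ h y → x ≡ y) →
  countFin n A ≤ countFin N B
countFin-injection zero    A B h into inj = z≤n
countFin-injection (suc n) A B h into inj with A zero in A0
... | false = countFin-injection n (A ∘ suc) B (h ∘ suc) (into ∘ suc)
                (λ x y p q e → suc-injective (inj (suc x) (suc y) p q e))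
... | true  = begin
  1 + countFin n (A ∘ suc) ≤⟨ +-monoʳ-≤ 1 (countFin-injection n (A ∘ suc) B′ (h ∘ suc) into′ inj′) ⟩
  1 + countFin _ B′        ≡⟨ cong (_+ countFin _ B′) (countFin-single _ B (h zero) (into zero A0)) ⟨
  countFin _ (λ y → B y ∧ (h zero =ᶠ y)) + countFin _ B′ ≡⟨ countFin-split _ B (h zero =ᶠ_) ⟨
  countFin _ B             ∎
  where
  open ≤-Reasoning
  B′ : _ → Bool
  B′ y = B y ∧ not (h zero =ᶠ y)
  into′ : ∀ x → A (suc x) ≡ true → B′ (h (suc x)) ≡ true
  into′ x Ax = ∧-intro (into (suc x) Ax)
    (cong not (¬-not (λ e → 0≢1+n (inj zero (suc x) A0 Ax (=ᶠ⇒≡ _ _ e)))))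
  inj′ : ∀ x y → A (suc x) ≡ true → A (suc y) ≡ true → h (suc x) ≡ h (suc y) → x ≡ y
  inj′ x y p q e = suc-injective (inj (suc x) (suc y) p q e)

countFin-⋃ : ∀ K n D (B : Fin K → Bool) (h : Fin K → Fin n → Bool) → (∀ w → countFin n (h w) ≤ D) →
  countFin n (λ y → anyFin K (λ w → B w ∧ h w y)) ≤ countFin K B * D
countFin-⋃ zero    n D B h hD = ≤-reflexive (countFin-false n (λ _ → refl))
countFin-⋃ (suc K) n D B h hD with B zero
... | true  = ≤-trans (countFin-∨ n (h zero) _)
                      (+-mono-≤ (hD zero) (countFin-⋃ K n D (B ∘ suc) (h ∘ suc) (hD ∘ suc)))
... | false = countFin-⋃ K n D (B ∘ suc) (h ∘ suc) (hD ∘ suc)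

countFin-+ : ∀ a b (f : Fin (a + b) → Bool) →
  countFin (a + b) f ≡ countFin a (λ i → f (i ↑ˡ b)) + countFin b (λ j → f (a ↑ʳ j))
countFin-+ zero    b f = refl
countFin-+ (suc a) b f = trans (cong ((if f zero then 1 else 0) +_) (countFin-+ a b (f ∘ suc)))
                               (≡-sym (+-assoc (if f zero then 1 else 0) _ _))

countFin-const : ∀ a b → countFin a (λ _ → b) ≡ a * (if b then 1 else 0)
countFin-const zero    b = refl
countFin-const (suc a) b = cong ((if b then 1 else 0) +_) (countFin-const a b)

countFin-quotient : ∀ n m (f : Fin n → Bool) → countFin (n * m) (f ∘ quotient {n} m) ≡ m * countFin n f
countFin-quotient zero    m f = ≡-sym (*-zeroʳ m)
countFin-quotient (suc n) m f = begin
  countFin (m + n * m) (f ∘ quotient m)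
    ≡⟨ countFin-+ m (n * m) _ ⟩
  countFin m (λ i → f (quotient m (i ↑ˡ (n * m)))) + countFin (n * m) (λ j → f (quotient m (m ↑ʳ j)))
    ≡⟨ cong₂ _+_ (countFin-cong m (cong f ∘ quotient-↑ˡ)) (countFin-cong (n * m) (cong f ∘ quotient-↑ʳ)) ⟩
  countFin m (λ _ → f zero) + countFin (n * m) (f ∘ suc ∘ quotient {n} m)
    ≡⟨ cong₂ _+_ (countFin-const m (f zero)) (countFin-quotient n m (f ∘ suc)) ⟩
  m * (if f zero then 1 else 0) + m * countFin n (f ∘ suc)
    ≡⟨ *-distribˡ-+ m (if f zero then 1 else 0) _ ⟨
  m * countFin (suc n) f ∎
  where
  open ≡-Reasoning
  quotient-↑ˡ : ∀ i → quotient {suc n} m (i ↑ˡ (n * m)) ≡ zero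
  quotient-↑ˡ i rewrite splitAt-↑ˡ m i (n * m) = refl
  quotient-↑ʳ : ∀ j → quotient {suc n} m (m ↑ʳ j) ≡ suc (quotient {n} m j)
  quotient-↑ʳ j rewrite splitAt-↑ʳ m (n * m) j = refl

rank : ∀ {n} → (Fin n → Bool) → Fin n → ℕ
rank A zero    = 0
rank A (suc x) = (if A zero then 1 else 0) + rank (A ∘ suc) x

select : ∀ {n} → (Fin n → Bool) → ℕ → Maybe (Fin n)
select {zero}  A i = nothing
select {suc n} A i with A zero | i
... | true  | zero  = just zero
... | true  | suc j = Maybe.map suc (select (A ∘ suc) j)
... | false | _     = Maybe.map suc (select (A ∘ suc) i)

select-rank : ∀ {n} (A : Fin n → Bool) x → A x ≡ true → select A (rank A x) ≡ just x
select-rank {suc n} A zero    Ax rewrite Ax = refl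
select-rank {suc n} A (suc x) Ax with A zero
... | true  = map-just (select-rank (A ∘ suc) x Ax)
... | false = map-just (select-rank (A ∘ suc) x Ax)

rank-select : ∀ {n} (A : Fin n → Bool) i x → select A i ≡ just x → A x ≡ true × rank A x ≡ i
rank-select {suc n} A i x e with A zero in A0 | i
rank-select {suc n} A i zero e | true | zero = A0 , refl
rank-select {suc n} A i x e | true | suc j with select (A ∘ suc) j in e′ | x | e
... | just y | .(suc y) | refl rewrite A0 = Data.Product.map₂ (cong suc) (rank-select (A ∘ suc) j y e′)
rank-select {suc n} A i x e | false | k with select (A ∘ suc) k in e′ | x | e
... | just y | .(suc y) | refl rewrite A0 = rank-select (A ∘ suc) k y e′

rank<countFin : ∀ {n} (A : Fin n → Bool) x → A x ≡ true → rank A x < countFin n A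
rank<countFin {suc n} A zero    Ax rewrite Ax = s≤s z≤n
rank<countFin {suc n} A (suc x) Ax = +-monoʳ-< (if A zero then 1 else 0) (rank<countFin (A ∘ suc) x Ax)

allVectors : ∀ L → List (Vector Bool L)
allVectors zero    = (λ ()) ∷ []
allVectors (suc L) = map (true ∷ᵛ_) (allVectors L) ++ map (false ∷ᵛ_) (allVectors L)

length-allVectors : ∀ L → length (allVectors L) ≡ 2 ^ L
length-allVectors zero    = refl
length-allVectors (suc L) = begin
  length (map (true ∷ᵛ_) vs ++ map (false ∷ᵛ_) vs)    ≡⟨ length-++ (map (true ∷ᵛ_) vs) ⟩
  length (map (true ∷ᵛ_) vs) + length (map (false ∷ᵛ_) vs) ≡⟨ cong₂ _+_ (length-map _ vs) (length-map _ vs) ⟩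
  length vs + length vs                              ≡⟨ cong₂ _+_ (length-allVectors L) (length-allVectors L) ⟩
  2 ^ L + 2 ^ L                                      ≡⟨ cong (2 ^ L +_) (+-identityʳ (2 ^ L)) ⟨
  2 ^ suc L                                          ∎
  where
  open ≡-Reasoning
  vs = allVectors L

≗-∷ : ∀ {L} {v : Vector Bool (suc L)} {b w} → v zero ≡ b → v ∘ suc ≗ w → v ≗ b ∷ᵛ w
≗-∷ v0 _     zero    = v0
≗-∷ _  tail≗ (suc i) = tail≗ i

allVectors-complete : ∀ L (v : Vector Bool L) → Any (v ≗_) (allVectors L)
allVectors-complete zero    v = here (λ ())
allVectors-complete (suc L) v with v zero in v0
... | true  = Anyₚ.++⁺ˡ (Anyₚ.map⁺ (Any.map (≗-∷ v0) (allVectors-complete L (v ∘ suc))))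
... | false = Anyₚ.++⁺ʳ (map (true ∷ᵛ_) (allVectors L))
                (Anyₚ.map⁺ (Any.map (≗-∷ v0) (allVectors-complete L (v ∘ suc))))

¬¬-decide : ∀ n (A : Fin n → Set) → ¬ ¬ (∀ i → Dec (A i))
¬¬-decide zero    A k = k (λ ())
¬¬-decide (suc n) A k =
  ¬¬-excluded-middle λ A0? → ¬¬-decide n (A ∘ suc) λ A? → k λ { zero → A0? ; (suc i) → A? i }

-- An element at distance > 2r+1 from σ has an r-ball disjoint from, and not adjacent to, the r-ball
-- of σ; an element at distance ≤ 2r+1 has its r-ball inside the (3r+1)-ball of σ.
sepRadius : ℕ → ℕ
sepRadius r = suc (r + r)

extRadius : ℕ → ℕ
extRadius r = suc (r + r + r)

r≤extRadius : ∀ r → r ≤ extRadius r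
r≤extRadius r = ≤-trans (m≤m+n r r) (≤-trans (m≤m+n (r + r) r) (n≤1+n _))

sepRadius≤extRadius : ∀ r → sepRadius r ≤ extRadius r
sepRadius≤extRadius r = s≤s (m≤m+n (r + r) r)

ballBound : ℕ → ℕ → ℕ
ballBound D zero    = 1
ballBound D (suc r) = ballBound D r + ballBound D r * D

radius : ∀ {m p k} → Formula m p k → ℕ
radius (neg φ)   = radius φ
radius (and φ ψ) = radius φ ⊔ radius ψ
radius (or φ ψ)  = radius φ ⊔ radius ψ
radius (ex φ)    = extRadius (radius φ)
radius (fa φ)    = extRadius (radius φ)
radius _         = 0

module Gaifman {m p : ℕ} (S : Structure m p) where

  N : ℕ
  N = size S

  related : Fin N → Fin N → Bool
  related x y = relE S x y ∨ rel∼ S x y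

  adjacent : Fin N → Fin N → Bool
  adjacent x y = related x y ∨ related y x

  adjacent-sym : ∀ x y → adjacent x y ≡ adjacent y x
  adjacent-sym x y = ∨-comm (related x y) (related y x)

  dist≤ : ℕ → Fin N → Fin N → Bool
  dist≤ zero    x y = x =ᶠ y
  dist≤ (suc r) x y = dist≤ r x y ∨ anyFin N (λ w → dist≤ r x w ∧ adjacent w y)

  dist≤-refl : ∀ r x → dist≤ r x x ≡ true
  dist≤-refl zero    x = =ᶠ-refl x
  dist≤-refl (suc r) x = ∨-introˡ _ (dist≤-refl r x)

  dist≤-step : ∀ r {x} w {y} → dist≤ r x w ≡ true → adjacent w y ≡ true → dist≤ (suc r) x y ≡ true
  dist≤-step r w d a = ∨-introʳ (dist≤ r _ _) (anyFin-intro N _ w (∧-intro d a))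

  dist≤-mono : ∀ {r R} → r ≤ R → ∀ x y → dist≤ r x y ≡ true → dist≤ R x y ≡ true
  dist≤-mono r≤R = go (≤⇒≤′ r≤R)
    where
    go : ∀ {r R} → r ≤′ R → ∀ x y → dist≤ r x y ≡ true → dist≤ R x y ≡ true
    go ≤′-refl        x y d = d
    go (≤′-step r≤′R) x y d = ∨-introˡ _ (go r≤′R x y d)

  dist≤-trans : ∀ a b {x y z} → dist≤ a x y ≡ true → dist≤ b y z ≡ true → dist≤ (a + b) x z ≡ true
  dist≤-trans a zero {x} {y} {z} d e rewrite =ᶠ⇒≡ y z e = dist≤-mono (m≤m+n a 0) x z d
  dist≤-trans a (suc b) {x} {y} {z} d e with ∨-elim (dist≤ b y z) _ e
  ... | inj₁ e′ = dist≤-mono (+-monoʳ-≤ a (n≤1+n b)) x z (dist≤-trans a b d e′)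
  ... | inj₂ e′ with anyFin-elim N _ e′
  ... | w , e″ rewrite +-suc a b =
    dist≤-step (a + b) w (dist≤-trans a b d (∧-conicalˡ _ _ e″)) (∧-conicalʳ _ _ e″)

  adjacent⇒dist≤1 : ∀ x y → adjacent x y ≡ true → dist≤ 1 x y ≡ true
  adjacent⇒dist≤1 x y = dist≤-step 0 x (dist≤-refl 0 x)

  dist≤-sym : ∀ r x y → dist≤ r x y ≡ true → dist≤ r y x ≡ true
  dist≤-sym zero    x y d = trans (=ᶠ-sym y x) d
  dist≤-sym (suc r) x y d with ∨-elim (dist≤ r x y) _ d
  ... | inj₁ d′ = ∨-introˡ _ (dist≤-sym r x y d′)
  ... | inj₂ d′ with anyFin-elim N _ d′
  ... | w , e = dist≤-trans 1 r
      (adjacent⇒dist≤1 y w (trans (adjacent-sym y w) (∧-conicalʳ _ _ e)))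
      (dist≤-sym r x w (∧-conicalˡ _ _ e))

  relE⇒adjacent : ∀ x y → relE S x y ≡ true → adjacent x y ≡ true
  relE⇒adjacent x y e = ∨-introˡ _ (∨-introˡ _ e)

  rel∼⇒adjacent : ∀ x y → rel∼ S x y ≡ true → adjacent x y ≡ true
  rel∼⇒adjacent x y e = ∨-introˡ _ (∨-introʳ (relE S x y) e)

  ball : ∀ {k} → ℕ → (Fin k → Fin N) → Fin N → Bool
  ball {k} r σ x = anyFin k (λ i → dist≤ r (σ i) x)

  ball-intro : ∀ {k} r (σ : Fin k → Fin N) i x → dist≤ r (σ i) x ≡ true → ball r σ x ≡ true
  ball-intro {k} r σ i x = anyFin-intro k _ i

  ball-elim : ∀ {k} r (σ : Fin k → Fin N) x → ball r σ x ≡ true → ∃[ i ] dist≤ r (σ i) x ≡ true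
  ball-elim {k} r σ x = anyFin-elim k _

  ball-centre : ∀ {k} r (σ : Fin k → Fin N) i → ball r σ (σ i) ≡ true
  ball-centre r σ i = ball-intro r σ i (σ i) (dist≤-refl r (σ i))

  ball-mono : ∀ {k r R} → r ≤ R → (σ : Fin k → Fin N) → ∀ x → ball r σ x ≡ true → ball R σ x ≡ true
  ball-mono {r = r} {R} r≤R σ x b with ball-elim r σ x b
  ... | i , d = ball-intro R σ i x (dist≤-mono r≤R _ x d)

  ball₁⇒dist≤ : ∀ r c x → ball r (σ₁ c) x ≡ true → dist≤ r c x ≡ true
  ball₁⇒dist≤ r c x b with ∨-elim (dist≤ r c x) false b
  ... | inj₁ d = d

  dist≤⇒ball₁ : ∀ r c x → dist≤ r c x ≡ true → ball r (σ₁ c) x ≡ true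
  dist≤⇒ball₁ r c x = ∨-introˡ false

  record PartialIso (A B : Fin N → Bool) : Set where
    field
      to from   : Fin N → Fin N
      to-∈      : ∀ x → A x ≡ true → B (to x) ≡ true
      from-∈    : ∀ y → B y ≡ true → A (from y) ≡ true
      from∘to   : ∀ x → A x ≡ true → from (to x) ≡ x
      to∘from   : ∀ y → B y ≡ true → to (from y) ≡ y
      relE-pres : ∀ x y → A x ≡ true → A y ≡ true → relE S x y ≡ relE S (to x) (to y)
      rel∼-pres : ∀ x y → A x ≡ true → A y ≡ true → rel∼ S x y ≡ rel∼ S (to x) (to y)
      relQ-pres : ∀ i x → A x ≡ true → relQ S i x ≡ relQ S i (to x)
      relP-pres : ∀ j x → A x ≡ true → relP S j x ≡ relP S j (to x)

  open PartialIso

  PartialIso-id : ∀ A → PartialIso A A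
  PartialIso-id A = record
    { to = λ x → x ; from = λ x → x ; to-∈ = λ _ a → a ; from-∈ = λ _ a → a
    ; from∘to = λ _ _ → refl ; to∘from = λ _ _ → refl
    ; relE-pres = λ _ _ _ _ → refl ; rel∼-pres = λ _ _ _ _ → refl
    ; relQ-pres = λ _ _ _ → refl ; relP-pres = λ _ _ _ → refl }

  PartialIso-sym : ∀ {A B} → PartialIso A B → PartialIso B A
  PartialIso-sym I = record
    { to = from I ; from = to I ; to-∈ = from-∈ I ; from-∈ = to-∈ I
    ; from∘to = to∘from I ; to∘from = from∘to I
    ; relE-pres = λ x y bx by → ≡-sym (trans (relE-pres I _ _ (from-∈ I x bx) (from-∈ I y by))
                                             (cong₂ (relE S) (to∘from I x bx) (to∘from I y by)))
    ; rel∼-pres = λ x y bx by → ≡-sym (trans (rel∼-pres I _ _ (from-∈ I x bx) (from-∈ I y by))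
                                             (cong₂ (rel∼ S) (to∘from I x bx) (to∘from I y by)))
    ; relQ-pres = λ i x bx → ≡-sym (trans (relQ-pres I i _ (from-∈ I x bx)) (cong (relQ S i) (to∘from I x bx)))
    ; relP-pres = λ j x bx → ≡-sym (trans (relP-pres I j _ (from-∈ I x bx)) (cong (relP S j) (to∘from I x bx)))
    }

  PartialIso-trans : ∀ {A B C} → PartialIso A B → PartialIso B C → PartialIso A C
  PartialIso-trans I J = record
    { to = to J ∘ to I ; from = from I ∘ from J
    ; to-∈ = λ x a → to-∈ J _ (to-∈ I x a) ; from-∈ = λ z c → from-∈ I _ (from-∈ J z c)
    ; from∘to = λ x a → trans (cong (from I) (from∘to J _ (to-∈ I x a))) (from∘to I x a)
    ; to∘from = λ z c → trans (cong (to J) (to∘from I _ (from-∈ J z c))) (to∘from J z c)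
    ; relE-pres = λ x y a b → trans (relE-pres I x y a b) (relE-pres J _ _ (to-∈ I x a) (to-∈ I y b))
    ; rel∼-pres = λ x y a b → trans (rel∼-pres I x y a b) (rel∼-pres J _ _ (to-∈ I x a) (to-∈ I y b))
    ; relQ-pres = λ i x a → trans (relQ-pres I i x a) (relQ-pres J i _ (to-∈ I x a))
    ; relP-pres = λ j x a → trans (relP-pres I j x a) (relP-pres J j _ (to-∈ I x a))
    }

  PartialIso-from-injective : ∀ {A B} (I : PartialIso A B) {x y} → B x ≡ true → B y ≡ true →
    from I x ≡ from I y → x ≡ y
  PartialIso-from-injective I {x} {y} Bx By e =
    trans (≡-sym (to∘from I x Bx)) (trans (cong (to I) e) (to∘from I y By))

  PartialIso-restrict : ∀ {A B A′ B′} (I : PartialIso A B) →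
    (∀ x → A′ x ≡ true → A x ≡ true) → (∀ y → B′ y ≡ true → B y ≡ true) →
    (∀ x → A′ x ≡ true → B′ (to I x) ≡ true) → (∀ y → B′ y ≡ true → A′ (from I y) ≡ true) →
    PartialIso A′ B′
  PartialIso-restrict I A′⊆A B′⊆B to-∈′ from-∈′ = record
    { to = to I ; from = from I ; to-∈ = to-∈′ ; from-∈ = from-∈′
    ; from∘to = λ x a → from∘to I x (A′⊆A x a) ; to∘from = λ y b → to∘from I y (B′⊆B y b)
    ; relE-pres = λ x y a b → relE-pres I x y (A′⊆A x a) (A′⊆A y b)
    ; rel∼-pres = λ x y a b → rel∼-pres I x y (A′⊆A x a) (A′⊆A y b)
    ; relQ-pres = λ i x a → relQ-pres I i x (A′⊆A x a)
    ; relP-pres = λ j x a → relP-pres I j x (A′⊆A x a) }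

  adjacent-pres : ∀ {A B} (I : PartialIso A B) x y → A x ≡ true → A y ≡ true →
    adjacent x y ≡ adjacent (to I x) (to I y)
  adjacent-pres I x y a b =
    cong₂ _∨_ (cong₂ _∨_ (relE-pres I x y a b) (rel∼-pres I x y a b))
              (cong₂ _∨_ (relE-pres I y x b a) (rel∼-pres I y x b a))

  dist≤-pres : ∀ {A B} (I : PartialIso A B) r c → (∀ z → dist≤ r c z ≡ true → A z ≡ true) →
    ∀ x → dist≤ r c x ≡ true → dist≤ r (to I c) (to I x) ≡ true
  dist≤-pres I zero    c _ x d rewrite =ᶠ⇒≡ c x d = dist≤-refl 0 (to I x)
  dist≤-pres I (suc r) c A⊇ball x d with ∨-elim (dist≤ r c x) _ d
  ... | inj₁ d′ = ∨-introˡ _ (dist≤-pres I r c (λ z → A⊇ball z ∘ ∨-introˡ _) x d′)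
  ... | inj₂ d′ with anyFin-elim N _ d′
  ... | w , e = dist≤-step r (to I w)
     (dist≤-pres I r c (λ z → A⊇ball z ∘ ∨-introˡ _) w (∧-conicalˡ _ _ e))
     (trans (≡-sym (adjacent-pres I w x (A⊇ball w (dist≤-mono (n≤1+n r) c w (∧-conicalˡ _ _ e))) (A⊇ball x d)))
            (∧-conicalʳ _ _ e))

  infix 4 _≃⟨_⟩_

  record _≃⟨_⟩_ {k} (σ : Fin k → Fin N) (r : ℕ) (σ′ : Fin k → Fin N) : Set where
    constructor mk≃
    field
      iso     : PartialIso (ball r σ) (ball r σ′)
      centres : ∀ i → to iso (σ i) ≡ σ′ i

  open _≃⟨_⟩_

  ≃-refl : ∀ {k r} (σ : Fin k → Fin N) → σ ≃⟨ r ⟩ σ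
  ≃-refl σ = mk≃ (PartialIso-id _) (λ _ → refl)

  ≃-sym : ∀ {k r} {σ σ′ : Fin k → Fin N} → σ ≃⟨ r ⟩ σ′ → σ′ ≃⟨ r ⟩ σ
  ≃-sym {r = r} {σ} (mk≃ I c) =
    mk≃ (PartialIso-sym I) (λ i → trans (cong (from I) (≡-sym (c i))) (from∘to I (σ i) (ball-centre r σ i)))

  ≃-trans : ∀ {k r} {σ σ′ σ″ : Fin k → Fin N} → σ ≃⟨ r ⟩ σ′ → σ′ ≃⟨ r ⟩ σ″ → σ ≃⟨ r ⟩ σ″
  ≃-trans (mk≃ I c) (mk≃ J c′) = mk≃ (PartialIso-trans I J) (λ i → trans (cong (to J) (c i)) (c′ i))

  dist≤-transport : ∀ {k r R} {σ σ′ : Fin k → Fin N} (J : σ ≃⟨ R ⟩ σ′) → r ≤ R →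
    ∀ i x → dist≤ r (σ i) x ≡ true → dist≤ r (σ′ i) (to (iso J) x) ≡ true
  dist≤-transport {r = r} {R} {σ} (mk≃ I c) r≤R i x d =
    subst (λ z → dist≤ r z (to I x) ≡ true) (c i)
      (dist≤-pres I r (σ i) (λ z d′ → ball-intro R σ i z (dist≤-mono r≤R _ z d′)) x d)

  ball-transport : ∀ {k r R} {σ σ′ : Fin k → Fin N} (J : σ ≃⟨ R ⟩ σ′) → r ≤ R →
    ∀ x → ball r σ x ≡ true → ball r σ′ (to (iso J) x) ≡ true
  ball-transport {r = r} {σ = σ} {σ′} J r≤R x b with ball-elim r σ x b
  ... | i , d = ball-intro r σ′ i _ (dist≤-transport J r≤R i x d)

  ≃-mono : ∀ {k r R} {σ σ′ : Fin k → Fin N} → r ≤ R → σ ≃⟨ R ⟩ σ′ → σ ≃⟨ r ⟩ σ′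
  ≃-mono {σ = σ} {σ′} r≤R J = mk≃
    (PartialIso-restrict (iso J) (ball-mono r≤R σ) (ball-mono r≤R σ′)
      (ball-transport J r≤R) (ball-transport (≃-sym J) r≤R))
    (centres J)

  near⇒dist≤-inside : ∀ {k} r (σ : Fin k → Fin N) a → ball (sepRadius r) σ a ≡ true →
    ∀ z → dist≤ r a z ≡ true → ball (extRadius r) σ z ≡ true
  near⇒dist≤-inside r σ a near z d with ball-elim (sepRadius r) σ a near
  ... | i , d′ = ball-intro (extRadius r) σ i z (dist≤-trans (sepRadius r) r d′ d)

  near⇒ball-inside : ∀ {k} r (σ : Fin k → Fin N) a → ball (sepRadius r) σ a ≡ true →
    ∀ x → ball r (extend σ a) x ≡ true → ball (extRadius r) σ x ≡ true
  near⇒ball-inside r σ a near x b with ∨-elim (dist≤ r a x) _ b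
  ... | inj₁ d = near⇒dist≤-inside r σ a near x d
  ... | inj₂ b′ = ball-mono (r≤extRadius r) σ x b′

  near-ball-transport : ∀ {k} r {σ σ′ : Fin k → Fin N} (J : σ ≃⟨ extRadius r ⟩ σ′) a →
    ball (sepRadius r) σ a ≡ true →
    ∀ x → ball r (extend σ a) x ≡ true → ball r (extend σ′ (to (iso J) a)) (to (iso J) x) ≡ true
  near-ball-transport r {σ} J a near x b with ∨-elim (dist≤ r a x) _ b
  ... | inj₁ d  = ∨-introˡ _ (dist≤-pres (iso J) r a (near⇒dist≤-inside r σ a near) x d)
  ... | inj₂ b′ = ∨-introʳ (dist≤ r _ _) (ball-transport J (r≤extRadius r) x b′)

  ≃-extend-near : ∀ {k} r {σ σ′ : Fin k → Fin N} (J : σ ≃⟨ extRadius r ⟩ σ′) a →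
    ball (sepRadius r) σ a ≡ true → extend σ a ≃⟨ r ⟩ extend σ′ (to (iso J) a)
  ≃-extend-near r {σ} {σ′} J a near = mk≃
    (PartialIso-restrict I (near⇒ball-inside r σ a near) (near⇒ball-inside r σ′ (to I a) near′)
      (near-ball-transport r J a near)
      (λ y b → subst (λ z → ball r (extend σ z) (from I y) ≡ true) (from∘to I a a∈)
                 (near-ball-transport r (≃-sym J) (to I a) near′ y b)))
    (λ { zero → refl ; (suc i) → centres J i })
    where
    I : PartialIso (ball (extRadius r) σ) (ball (extRadius r) σ′)
    I = iso J
    near′ : ball (sepRadius r) σ′ (to I a) ≡ true
    near′ = ball-transport J (sepRadius≤extRadius r) a near
    a∈ : ball (extRadius r) σ a ≡ true
    a∈ = ball-mono (sepRadius≤extRadius r) σ a near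

  ≃-restrict-centre : ∀ {k r R} {τ τ′ : Fin k → Fin N} (J : τ ≃⟨ R ⟩ τ′) c →
    (∀ z → dist≤ r c z ≡ true → ball R τ z ≡ true) →
    (∀ z → dist≤ r (to (iso J) c) z ≡ true → ball R τ′ z ≡ true) →
    σ₁ c ≃⟨ r ⟩ σ₁ (to (iso J) c)
  ≃-restrict-centre {r = r} {R} {τ} {τ′} J c inside inside′ = mk≃
    (PartialIso-restrict I (λ x → inside x ∘ ball₁⇒dist≤ r c x) (λ y → inside′ y ∘ ball₁⇒dist≤ r _ y)
      (λ x b → dist≤⇒ball₁ r _ _ (dist≤-pres I r c inside x (ball₁⇒dist≤ r c x b)))
      (λ y b → dist≤⇒ball₁ r c _
        (subst (λ z → dist≤ r z (from I y) ≡ true) (from∘to I c (inside c (dist≤-refl r c)))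
          (dist≤-pres (PartialIso-sym I) r (to I c) inside′ y (ball₁⇒dist≤ r _ y b)))))
    (λ { zero → refl })
    where
    I : PartialIso (ball R τ) (ball R τ′)
    I = iso J

  ≃-near-centre : ∀ {k} r {σ σ′ : Fin k → Fin N} (J : σ ≃⟨ extRadius r ⟩ σ′) x →
    ball (sepRadius r) σ x ≡ true → σ₁ x ≃⟨ r ⟩ σ₁ (to (iso J) x)
  ≃-near-centre r {σ} {σ′} J x near = ≃-restrict-centre J x (near⇒dist≤-inside r σ x near)
    (near⇒dist≤-inside r σ′ _ (ball-transport J (sepRadius≤extRadius r) x near))

  far⇒outside : ∀ {k} r (σ : Fin k → Fin N) a x → ball (sepRadius r) σ a ≡ false →
    dist≤ r a x ≡ true → ball r σ x ≡ false
  far⇒outside r σ a x far d = ¬-not near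
    where
    near : ball r σ x ≢ true
    near b with ball-elim r σ x b
    ... | i , d′ = true≢false (ball-intro (sepRadius r) σ i a
                     (dist≤-mono (n≤1+n (r + r)) _ a (dist≤-trans r r d′ (dist≤-sym r a x d)))) far

  far⇒non-adjacent : ∀ {k} r (σ : Fin k → Fin N) a x y → ball (sepRadius r) σ a ≡ false →
    ball r σ x ≡ true → dist≤ r a y ≡ true → adjacent x y ≡ false
  far⇒non-adjacent r σ a x y far b d = ¬-not λ adj → true≢false (near adj) far
    where
    near : adjacent x y ≡ true → ball (sepRadius r) σ a ≡ true
    near adj with ball-elim r σ x b
    ... | i , d′ = ball-intro (sepRadius r) σ i a (dist≤-mono (≤-reflexive (cong (_+ r) (+-comm r 1))) _ a
                     (dist≤-trans (r + 1) r (dist≤-trans r 1 d′ (adjacent⇒dist≤1 x y adj)) (dist≤-sym r a y d)))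

  non-adjacent⇒false : (B : Fin N → Fin N → Bool) → (∀ x y → B x y ≡ true → adjacent x y ≡ true) →
    ∀ {x y} → adjacent x y ≡ false → B x y ≡ false
  non-adjacent⇒false B B⇒adj na = ¬-not λ e → true≢false (B⇒adj _ _ e) na

  data Part {k} (r : ℕ) (σ : Fin k → Fin N) (a x : Fin N) : Set where
    old : ball r σ x ≡ true → Part r σ a x
    new : ball r σ x ≡ false → dist≤ r a x ≡ true → Part r σ a x

  part : ∀ {k} r (σ : Fin k → Fin N) a x → ball r (extend σ a) x ≡ true → Part r σ a x
  part r σ a x b with ball r σ x in bx
  ... | true  = old bx
  ... | false with ∨-elim (dist≤ r a x) _ b
  ... | inj₁ d = new bx d

  module Glue {k} r {σ σ′ : Fin k → Fin N} (J : σ ≃⟨ r ⟩ σ′) {a a′ : Fin N} (K : σ₁ a ≃⟨ r ⟩ σ₁ a′)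
              (far : ball (sepRadius r) σ a ≡ false) (far′ : ball (sepRadius r) σ′ a′ ≡ false) where

    I : PartialIso (ball r σ) (ball r σ′)
    I = iso J

    L : PartialIso (ball r (σ₁ a)) (ball r (σ₁ a′))
    L = iso K

    glue : Fin N → Fin N
    glue x = if ball r σ x then to I x else to L x

    unglue : Fin N → Fin N
    unglue y = if ball r σ′ y then from I y else from L y

    glue-old : ∀ x → ball r σ x ≡ true → glue x ≡ to I x
    glue-old x b rewrite b = refl

    glue-new : ∀ x → ball r σ x ≡ false → glue x ≡ to L x
    glue-new x b rewrite b = refl

    unglue-old : ∀ y → ball r σ′ y ≡ true → unglue y ≡ from I y
    unglue-old y b rewrite b = refl

    unglue-new : ∀ y → ball r σ′ y ≡ false → unglue y ≡ from L y
    unglue-new y b rewrite b = refl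

    L-dist≤ : ∀ x → dist≤ r a x ≡ true → dist≤ r a′ (to L x) ≡ true
    L-dist≤ x d = ball₁⇒dist≤ r a′ _ (to-∈ L x (dist≤⇒ball₁ r a x d))

    L⁻¹-dist≤ : ∀ y → dist≤ r a′ y ≡ true → dist≤ r a (from L y) ≡ true
    L⁻¹-dist≤ y d = ball₁⇒dist≤ r a _ (from-∈ L y (dist≤⇒ball₁ r a′ y d))

    glue-∈ : ∀ x → ball r (extend σ a) x ≡ true → ball r (extend σ′ a′) (glue x) ≡ true
    glue-∈ x b with part r σ a x b
    ... | old bx rewrite glue-old x bx = ∨-introʳ (dist≤ r a′ _) (to-∈ I x bx)
    ... | new bx d rewrite glue-new x bx = ∨-introˡ _ (L-dist≤ x d)

    unglue-∈ : ∀ y → ball r (extend σ′ a′) y ≡ true → ball r (extend σ a) (unglue y) ≡ true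
    unglue-∈ y b with part r σ′ a′ y b
    ... | old by rewrite unglue-old y by = ∨-introʳ (dist≤ r a _) (from-∈ I y by)
    ... | new by d rewrite unglue-new y by = ∨-introˡ _ (L⁻¹-dist≤ y d)

    unglue∘glue : ∀ x → ball r (extend σ a) x ≡ true → unglue (glue x) ≡ x
    unglue∘glue x b with part r σ a x b
    ... | old bx rewrite glue-old x bx | unglue-old (to I x) (to-∈ I x bx) = from∘to I x bx
    ... | new bx d rewrite glue-new x bx | unglue-new (to L x) (far⇒outside r σ′ a′ _ far′ (L-dist≤ x d)) =
      from∘to L x (dist≤⇒ball₁ r a x d)

    glue∘unglue : ∀ y → ball r (extend σ′ a′) y ≡ true → glue (unglue y) ≡ y
    glue∘unglue y b with part r σ′ a′ y b
    ... | old by rewrite unglue-old y by | glue-old (from I y) (from-∈ I y by) = to∘from I y by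
    ... | new by d rewrite unglue-new y by | glue-new (from L y) (far⇒outside r σ a _ far (L⁻¹-dist≤ y d)) =
      to∘from L y (dist≤⇒ball₁ r a′ y d)

    glue-pres₂ : (B : Fin N → Fin N → Bool) → (∀ x y → B x y ≡ true → adjacent x y ≡ true) →
      (∀ x y → ball r σ x ≡ true → ball r σ y ≡ true → B x y ≡ B (to I x) (to I y)) →
      (∀ x y → ball r (σ₁ a) x ≡ true → ball r (σ₁ a) y ≡ true → B x y ≡ B (to L x) (to L y)) →
      ∀ x y → ball r (extend σ a) x ≡ true → ball r (extend σ a) y ≡ true → B x y ≡ B (glue x) (glue y)
    glue-pres₂ B B⇒adj I-pres L-pres x y bx by with part r σ a x bx | part r σ a y by
    ... | old bx′ | old by′ rewrite glue-old x bx′ | glue-old y by′ = I-pres x y bx′ by′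
    ... | new bx′ dx | new by′ dy rewrite glue-new x bx′ | glue-new y by′ =
      L-pres x y (dist≤⇒ball₁ r a x dx) (dist≤⇒ball₁ r a y dy)
    ... | old bx′ | new by′ dy rewrite glue-old x bx′ | glue-new y by′ = trans
      (non-adjacent⇒false B B⇒adj (far⇒non-adjacent r σ a x y far bx′ dy))
      (≡-sym (non-adjacent⇒false B B⇒adj (far⇒non-adjacent r σ′ a′ _ _ far′ (to-∈ I x bx′) (L-dist≤ y dy))))
    ... | new bx′ dx | old by′ rewrite glue-new x bx′ | glue-old y by′ = trans
      (non-adjacent⇒false B B⇒adj (trans (adjacent-sym x y) (far⇒non-adjacent r σ a y x far by′ dx)))
      (≡-sym (non-adjacent⇒false B B⇒adj
        (trans (adjacent-sym _ _) (far⇒non-adjacent r σ′ a′ _ _ far′ (to-∈ I y by′) (L-dist≤ x dx)))))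

    glue-pres₁ : (U : Fin N → Bool) →
      (∀ x → ball r σ x ≡ true → U x ≡ U (to I x)) → (∀ x → ball r (σ₁ a) x ≡ true → U x ≡ U (to L x)) →
      ∀ x → ball r (extend σ a) x ≡ true → U x ≡ U (glue x)
    glue-pres₁ U I-pres L-pres x b with part r σ a x b
    ... | old bx rewrite glue-old x bx = I-pres x bx
    ... | new bx d rewrite glue-new x bx = L-pres x (dist≤⇒ball₁ r a x d)

    glued : extend σ a ≃⟨ r ⟩ extend σ′ a′
    glued = mk≃ (record
      { to = glue ; from = unglue ; to-∈ = glue-∈ ; from-∈ = unglue-∈
      ; from∘to = unglue∘glue ; to∘from = glue∘unglue
      ; relE-pres = glue-pres₂ (relE S) relE⇒adjacent (relE-pres I) (relE-pres L)
      ; rel∼-pres = glue-pres₂ (rel∼ S) rel∼⇒adjacent (rel∼-pres I) (rel∼-pres L)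
      ; relQ-pres = λ i → glue-pres₁ (relQ S i) (relQ-pres I i) (relQ-pres L i)
      ; relP-pres = λ j → glue-pres₁ (relP S j) (relP-pres I j) (relP-pres L j) })
      (λ { zero    → trans (glue-new a (far⇒outside r σ a a far (dist≤-refl r a))) (centres K zero)
         ; (suc i) → trans (glue-old (σ i) (ball-centre r σ i)) (centres J i) })

  -- σ and σ′ lie in the same structure, so they see the same number of r-twins of a. The twins near σ′
  -- inject into those near σ, and a is a twin that is not near σ, so some twin is not near σ′.
  -- Being an r-twin is not decidable here; the goals of eval-local are Boolean equations, which are
  -- stable under double negation.
  far-twin : ∀ {k} r {σ σ′ : Fin k → Fin N} (J : σ ≃⟨ extRadius r ⟩ σ′) a → ball (sepRadius r) σ a ≡ false →
    ¬ ¬ (∃[ a′ ] (σ₁ a ≃⟨ r ⟩ σ₁ a′ × ball (sepRadius r) σ′ a′ ≡ false))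
  far-twin r {σ} {σ′} J a far no-twin = ¬¬-decide N (λ x → σ₁ a ≃⟨ r ⟩ σ₁ x) counting
    where
    near near′ : Fin N → Bool
    near  = ball (sepRadius r) σ
    near′ = ball (sepRadius r) σ′
    J⁻¹ : σ′ ≃⟨ extRadius r ⟩ σ
    J⁻¹ = ≃-sym J

    counting : (∀ x → Dec (σ₁ a ≃⟨ r ⟩ σ₁ x)) → ⊥
    counting twin? = countFin-⊈ N twin near near′ a (twin-complete a (≃-refl (σ₁ a))) far
      (countFin-injection N _ _ (from (iso J)) move from-injective) twin⇒near′
      where
      twin : Fin N → Bool
      twin x = does (twin? x)
      twin-sound : ∀ x → twin x ≡ true → σ₁ a ≃⟨ r ⟩ σ₁ x
      twin-sound x t with twin? x
      ... | yes a≃x = a≃x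
      twin-complete : ∀ x → σ₁ a ≃⟨ r ⟩ σ₁ x → twin x ≡ true
      twin-complete x = dec-true (twin? x)
      twin⇒near′ : ∀ x → twin x ≡ true → near′ x ≡ true
      twin⇒near′ x t = ¬-not λ far′ → no-twin (x , twin-sound x t , far′)
      move : ∀ x → twin x ∧ near′ x ≡ true → twin (from (iso J) x) ∧ near (from (iso J) x) ≡ true
      move x t∧n = ∧-intro
        (twin-complete _ (≃-trans (twin-sound x (∧-conicalˡ _ _ t∧n)) (≃-near-centre r J⁻¹ x (∧-conicalʳ _ _ t∧n))))
        (ball-transport J⁻¹ (sepRadius≤extRadius r) x (∧-conicalʳ _ _ t∧n))
      from-injective : ∀ x y → twin x ∧ near′ x ≡ true → twin y ∧ near′ y ≡ true →
        from (iso J) x ≡ from (iso J) y → x ≡ y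
      from-injective x y tx ty = PartialIso-from-injective (iso J) (inside x tx) (inside y ty)
        where
        inside : ∀ z → twin z ∧ near′ z ≡ true → ball (extRadius r) σ′ z ≡ true
        inside z tz = ball-mono (sepRadius≤extRadius r) σ′ z (∧-conicalʳ _ _ tz)

  ≃-extend : ∀ {k} r {σ σ′ : Fin k → Fin N} → σ ≃⟨ extRadius r ⟩ σ′ →
    ∀ a → ¬ ¬ (∃[ a′ ] extend σ a ≃⟨ r ⟩ extend σ′ a′)
  ≃-extend r {σ} J a with ball (sepRadius r) σ a in a-near
  ... | true  = λ k → k (to (iso J) a , ≃-extend-near r J a a-near)
  ... | false = λ k → far-twin r J a a-near λ (a′ , a≃a′ , a′-far) →
                  k (a′ , Glue.glued r (≃-mono (r≤extRadius r) J) a≃a′ a-near a′-far)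

  eval-local : ∀ {k} (φ : Formula m p k) (σ σ′ : Fin k → Fin N) → σ ≃⟨ radius φ ⟩ σ′ →
    eval S φ σ ≡ eval S φ σ′
  eval-local tt        σ σ′ J = refl
  eval-local ff        σ σ′ J = refl
  eval-local (eq x y)  σ σ′ J = ≡-fromTrue⇔ (same J) (same (≃-sym J))
    where
    same : ∀ {τ τ′} → τ ≃⟨ 0 ⟩ τ′ → (τ x =ᶠ τ y) ≡ true → (τ′ x =ᶠ τ′ y) ≡ true
    same {τ} {τ′} (mk≃ I c) e = subst (λ z → (τ′ x =ᶠ z) ≡ true)
       (trans (≡-sym (c x)) (trans (cong (to I) (=ᶠ⇒≡ _ _ e)) (c y))) (=ᶠ-refl (τ′ x))
  eval-local (E x y)   σ σ′ (mk≃ I c) =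
    trans (relE-pres I _ _ (ball-centre 0 σ x) (ball-centre 0 σ y)) (cong₂ (relE S) (c x) (c y))
  eval-local (sim x y) σ σ′ (mk≃ I c) =
    trans (rel∼-pres I _ _ (ball-centre 0 σ x) (ball-centre 0 σ y)) (cong₂ (rel∼ S) (c x) (c y))
  eval-local (Q i x)   σ σ′ (mk≃ I c) = trans (relQ-pres I i _ (ball-centre 0 σ x)) (cong (relQ S i) (c x))
  eval-local (P j x)   σ σ′ (mk≃ I c) = trans (relP-pres I j _ (ball-centre 0 σ x)) (cong (relP S j) (c x))
  eval-local (neg φ)   σ σ′ J = cong not (eval-local φ σ σ′ J)
  eval-local (and φ ψ) σ σ′ J = cong₂ _∧_ (eval-local φ σ σ′ (≃-mono (m≤m⊔n (radius φ) (radius ψ)) J))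
                                          (eval-local ψ σ σ′ (≃-mono (m≤n⊔m (radius φ) (radius ψ)) J))
  eval-local (or φ ψ)  σ σ′ J = cong₂ _∨_ (eval-local φ σ σ′ (≃-mono (m≤m⊔n (radius φ) (radius ψ)) J))
                                          (eval-local ψ σ σ′ (≃-mono (m≤n⊔m (radius φ) (radius ψ)) J))
  eval-local (ex φ)    σ σ′ J = ≡-fromTrue⇔ (witness-transfer J) (witness-transfer (≃-sym J))
    where
    witness-transfer : ∀ {τ τ′} → τ ≃⟨ extRadius (radius φ) ⟩ τ′ →
      anyFin N (λ a → eval S φ (extend τ a)) ≡ true → anyFin N (λ a → eval S φ (extend τ′ a)) ≡ true
    witness-transfer K holds with anyFin-elim N _ holds
    ... | a , φa = decidable-stable (_ Bool.≟ true) λ k → ≃-extend (radius φ) K a λ (a′ , K′) →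
          k (anyFin-intro N _ a′ (trans (≡-sym (eval-local φ _ _ K′)) φa))
  eval-local (fa φ)    σ σ′ J = ≡-fromTrue⇔ (universal-transfer J) (universal-transfer (≃-sym J))
    where
    universal-transfer : ∀ {τ τ′} → τ ≃⟨ extRadius (radius φ) ⟩ τ′ →
      allFin N (λ a → eval S φ (extend τ a)) ≡ true → allFin N (λ a → eval S φ (extend τ′ a)) ≡ true
    universal-transfer K holds = allFin-intro N _ λ a′ → decidable-stable (_ Bool.≟ true) λ k →
      ≃-extend (radius φ) (≃-sym K) a′ λ (a , K′) → k (trans (eval-local φ _ _ K′) (allFin-elim N _ holds a))

  ball-size : ∀ D → (∀ x → countFin N (adjacent x) ≤ D) → ∀ r c → countFin N (dist≤ r c) ≤ ballBound D r
  ball-size D deg zero    c = countFin-≤1 N _ (λ x y d d′ → trans (≡-sym (=ᶠ⇒≡ c x d)) (=ᶠ⇒≡ c y d′))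
  ball-size D deg (suc r) c = ≤-trans (countFin-∨ N (dist≤ r c) _)
    (+-mono-≤ (ball-size D deg r c)
      (≤-trans (countFin-⋃ N N D (dist≤ r c) adjacent deg) (*-monoˡ-≤ D (ball-size D deg r c))))

codeLength : ℕ → ℕ → ℕ → ℕ
codeLength m p M = M + (M + (M * M + (M * M + (m * M + p * M))))

flatten : ∀ {a b} → (Fin a → Fin b → Bool) → Vector Bool (a * b)
flatten {b = b} h k = uncurry h (remQuot b k)

flatten-injective : ∀ {a b} {h h′ : Fin a → Fin b → Bool} → flatten h ≗ flatten h′ → ∀ i j → h i j ≡ h′ i j
flatten-injective {b = b} {h} {h′} h≗h′ i j = begin
  h i j                                ≡⟨ cong (uncurry h) (remQuot-combine i j) ⟨
  uncurry h (remQuot b (combine i j))  ≡⟨ h≗h′ (combine i j) ⟩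
  uncurry h′ (remQuot b (combine i j)) ≡⟨ cong (uncurry h′) (remQuot-combine i j) ⟩
  h′ i j                               ∎
  where open ≡-Reasoning

is-just⇒≡just : ∀ {A : Set} (d : A) {mx : Maybe A} → is-just mx ≡ true → mx ≡ just (fromMaybe d mx)
is-just⇒≡just d {just x} _ = refl

module BallCode {m p : ℕ} (S : Structure m p) (R M : ℕ)
                (ball-bounded : ∀ c → countFin (size S) (Gaifman.dist≤ S R c) ≤ M) where

  open Gaifman S
  open PartialIso

  slot : Fin N → Fin M → Maybe (Fin N)
  slot c i = select (dist≤ R c) (toℕ i)

  onSlot : (Fin N → Bool) → Maybe (Fin N) → Bool
  onSlot U (just x) = U x
  onSlot U nothing  = false

  onSlots : (Fin N → Fin N → Bool) → Maybe (Fin N) → Maybe (Fin N) → Bool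
  onSlots B (just x) (just y) = B x y
  onSlots B _        _        = false

  -- The R-ball of c, listed in increasing order in the first M slots, with its centre and relations.
  code : Fin N → Vector Bool (codeLength m p M)
  code c = (is-just ∘ slot c)
       ++ᵛ ((onSlot (_=ᶠ c) ∘ slot c)
       ++ᵛ (flatten (λ i j → onSlots (relE S) (slot c i) (slot c j))
       ++ᵛ (flatten (λ i j → onSlots (rel∼ S) (slot c i) (slot c j))
       ++ᵛ (flatten (λ q i → onSlot (relQ S q) (slot c i))
       ++ᵛ flatten (λ j i → onSlot (relP S j) (slot c i))))))

  record SameCode (c c′ : Fin N) : Set where
    field
      occupied  : ∀ i → is-just (slot c i) ≡ is-just (slot c′ i)
      centre    : ∀ i → onSlot (_=ᶠ c) (slot c i) ≡ onSlot (_=ᶠ c′) (slot c′ i)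
      relE-same : ∀ i j → onSlots (relE S) (slot c i) (slot c j) ≡ onSlots (relE S) (slot c′ i) (slot c′ j)
      rel∼-same : ∀ i j → onSlots (rel∼ S) (slot c i) (slot c j) ≡ onSlots (rel∼ S) (slot c′ i) (slot c′ j)
      relQ-same : ∀ q i → onSlot (relQ S q) (slot c i) ≡ onSlot (relQ S q) (slot c′ i)
      relP-same : ∀ j i → onSlot (relP S j) (slot c i) ≡ onSlot (relP S j) (slot c′ i)

  code-≗⇒SameCode : ∀ c c′ → code c ≗ code c′ → SameCode c c′
  code-≗⇒SameCode c c′ c≗c′ with ++-injective _ _ c≗c′
  ... | occ , c≗c′₁ with ++-injective _ _ c≗c′₁
  ... | cen , c≗c′₂ with ++-injective _ _ c≗c′₂
  ... | E≗  , c≗c′₃ with ++-injective _ _ c≗c′₃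
  ... | ∼≗  , c≗c′₄ with ++-injective _ _ c≗c′₄
  ... | Q≗ , P≗ = record
    { occupied = occ ; centre = cen
    ; relE-same = flatten-injective E≗ ; rel∼-same = flatten-injective ∼≗
    ; relQ-same = flatten-injective Q≗ ; relP-same = flatten-injective P≗ }

  module Transfer {c c′ : Fin N} (same : SameCode c c′) where

    open SameCode same

    -- The default x is a junk value, used only outside the R-ball of c.
    transfer : Fin N → Fin N
    transfer x = fromMaybe x (select (dist≤ R c′) (rank (dist≤ R c) x))

    slot-of : ∀ x → dist≤ R c x ≡ true → ∃[ i ] (slot c i ≡ just x × slot c′ i ≡ just (transfer x))
    slot-of x d = i , slot-c , slot-c′
      where
      rank<M : rank (dist≤ R c) x < M
      rank<M = ≤-trans (rank<countFin (dist≤ R c) x d) (ball-bounded c)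
      i : Fin M
      i = fromℕ< rank<M
      slot-c : slot c i ≡ just x
      slot-c = trans (cong (select (dist≤ R c)) (toℕ-fromℕ< rank<M)) (select-rank (dist≤ R c) x d)
      slot-c′ : slot c′ i ≡ just (transfer x)
      slot-c′ = trans (is-just⇒≡just x (trans (≡-sym (occupied i)) (cong is-just slot-c)))
                      (cong (λ k → just (fromMaybe x (select (dist≤ R c′) k))) (toℕ-fromℕ< rank<M))

    transfer-∈ : ∀ x → dist≤ R c x ≡ true → dist≤ R c′ (transfer x) ≡ true
    transfer-∈ x d with slot-of x d
    ... | i , _ , s′ = proj₁ (rank-select (dist≤ R c′) _ _ s′)

    rank-transfer : ∀ x → dist≤ R c x ≡ true → rank (dist≤ R c′) (transfer x) ≡ rank (dist≤ R c) x
    rank-transfer x d with slot-of x d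
    ... | i , s , s′ =
      trans (proj₂ (rank-select (dist≤ R c′) _ _ s′)) (≡-sym (proj₂ (rank-select (dist≤ R c) _ _ s)))

    transfer-back : ∀ x → dist≤ R c x ≡ true → ∀ d →
      fromMaybe d (select (dist≤ R c) (rank (dist≤ R c′) (transfer x))) ≡ x
    transfer-back x d y =
      cong (fromMaybe y) (trans (cong (select (dist≤ R c)) (rank-transfer x d)) (select-rank (dist≤ R c) x d))

    transfer-pres₂ : (B : Fin N → Fin N → Bool) →
      (∀ i j → onSlots B (slot c i) (slot c j) ≡ onSlots B (slot c′ i) (slot c′ j)) →
      ∀ x y → dist≤ R c x ≡ true → dist≤ R c y ≡ true → B x y ≡ B (transfer x) (transfer y)
    transfer-pres₂ B B-same x y dx dy with slot-of x dx | slot-of y dy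
    ... | i , sx , sx′ | j , sy , sy′ =
      trans (cong₂ (onSlots B) (≡-sym sx) (≡-sym sy)) (trans (B-same i j) (cong₂ (onSlots B) sx′ sy′))

    transfer-pres₁ : (U : Fin N → Bool) → (∀ i → onSlot U (slot c i) ≡ onSlot U (slot c′ i)) →
      ∀ x → dist≤ R c x ≡ true → U x ≡ U (transfer x)
    transfer-pres₁ U U-same x d with slot-of x d
    ... | i , s , s′ = trans (cong (onSlot U) (≡-sym s)) (trans (U-same i) (cong (onSlot U) s′))

    transfer-centre : transfer c ≡ c′
    transfer-centre with slot-of c (dist≤-refl R c)
    ... | i , s , s′ = =ᶠ⇒≡ _ _ (begin
      (transfer c =ᶠ c′)             ≡⟨ cong (onSlot (_=ᶠ c′)) s′ ⟨
      onSlot (_=ᶠ c′) (slot c′ i)    ≡⟨ centre i ⟨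
      onSlot (_=ᶠ c) (slot c i)      ≡⟨ cong (onSlot (_=ᶠ c)) s ⟩
      (c =ᶠ c)                       ≡⟨ =ᶠ-refl c ⟩
      true                           ∎)
      where open ≡-Reasoning

  code-≗⇒≃ : ∀ c c′ → code c ≗ code c′ → σ₁ c ≃⟨ R ⟩ σ₁ c′
  code-≗⇒≃ c c′ c≗c′ = mk≃ (record
    { to = F.transfer ; from = G.transfer
    ; to-∈   = λ x b → dist≤⇒ball₁ R c′ _ (F.transfer-∈ x (ball₁⇒dist≤ R c x b))
    ; from-∈ = λ y b → dist≤⇒ball₁ R c _ (G.transfer-∈ y (ball₁⇒dist≤ R c′ y b))
    ; from∘to = λ x b → F.transfer-back x (ball₁⇒dist≤ R c x b) _
    ; to∘from = λ y b → G.transfer-back y (ball₁⇒dist≤ R c′ y b) _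
    ; relE-pres = λ x y bx by →
        F.transfer-pres₂ (relE S) relE-same x y (ball₁⇒dist≤ R c x bx) (ball₁⇒dist≤ R c y by)
    ; rel∼-pres = λ x y bx by →
        F.transfer-pres₂ (rel∼ S) rel∼-same x y (ball₁⇒dist≤ R c x bx) (ball₁⇒dist≤ R c y by)
    ; relQ-pres = λ q x b → F.transfer-pres₁ (relQ S q) (relQ-same q) x (ball₁⇒dist≤ R c x b)
    ; relP-pres = λ j x b → F.transfer-pres₁ (relP S j) (relP-same j) x (ball₁⇒dist≤ R c x b) })
    (λ { zero → F.transfer-centre })
    where
    same : SameCode c c′
    same = code-≗⇒SameCode c c′ c≗c′
    open SameCode same
    module F = Transfer same
    module G = Transfer (code-≗⇒SameCode c′ c (≡-sym ∘ c≗c′))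

copyDegree : ℕ → ℕ → ℕ
copyDegree m d = (m * d + m) + (m * d + m)

copyExpand-degree : ∀ m p d (G : Graph) → MaxDegree≤ d G → (ps : Fin p → Fin (n G) → Bool) →
  let open Gaifman (copyExpand m p G ps) in ∀ x → countFin N (adjacent x) ≤ copyDegree m d
copyExpand-degree m p d G deg ps x =
  ≤-trans (countFin-∨ N (related x) (λ y → related y x)) (+-mono-≤ forward backward)
  where
  open Gaifman (copyExpand m p G ps)
  vertex : Fin N → Fin (n G)
  vertex = quotient m
  adj-bound : countFin N (λ y → adj G (vertex x) (vertex y)) ≤ m * d
  adj-bound = subst (_≤ m * d) (≡-sym (countFin-quotient (n G) m (adj G (vertex x)))) (*-monoʳ-≤ m (deg (vertex x)))
  same-vertex-bound : countFin N (λ y → vertex x =ᶠ vertex y) ≤ m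
  same-vertex-bound = subst (_≤ m) (≡-sym (countFin-quotient (n G) m (vertex x =ᶠ_)))
    (≤-trans (*-monoʳ-≤ m (countFin-≤1 (n G) _ λ v w e e′ → trans (≡-sym (=ᶠ⇒≡ _ _ e)) (=ᶠ⇒≡ _ _ e′)))
             (≤-reflexive (*-identityʳ m)))
  forward : countFin N (related x) ≤ m * d + m
  forward = ≤-trans (countFin-∨ N (relE (copyExpand m p G ps) x) _)
    (+-mono-≤ (≤-trans (countFin-mono N (λ y → ∧-conicalʳ _ _)) adj-bound) same-vertex-bound)
  backward : countFin N (λ y → related y x) ≤ m * d + m
  backward = ≤-trans (countFin-∨ N (λ y → relE (copyExpand m p G ps) y x) _)
    (+-mono-≤ (≤-trans (countFin-mono N (λ y e → trans (Graph.sym G (vertex x) (vertex y)) (∧-conicalʳ _ _ e))) adj-bound)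
              (≤-trans (countFin-mono N (λ y e → trans (=ᶠ-sym (vertex x) (vertex y)) e)) same-vertex-bound))

twinBound : ℕ → ℕ → ℕ
twinBound D r = ballBound D (sepRadius r) + ballBound D (sepRadius r)

module NearCover (τ : Transduction) (S : Structure (copies τ) (params τ)) (D : ℕ)
                 (deg : ∀ x → countFin (size S) (Gaifman.adjacent S x) ≤ D) where

  open Gaifman S

  R : ℕ
  R = radius (μ τ)

  L : ℕ
  L = codeLength (copies τ) (params τ) (ballBound D R)

  open BallCode S R (ballBound D R) (ball-size D deg R)

  far-agree : ∀ {u x} → σ₁ u ≃⟨ R ⟩ σ₁ x → ∀ w →
    dist≤ (sepRadius R) u w ≡ false → dist≤ (sepRadius R) x w ≡ false →
    eval S (μ τ) (σ₂ u w) ≡ eval S (μ τ) (σ₂ x w)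
  -- extend (σ₁ w) u and σ₂ u w have definitionally equal balls, so only the centres need converting.
  far-agree u≃x w u-far x-far = eval-local (μ τ) (σ₂ _ w) (σ₂ _ w)
    (mk≃ (iso glued) λ { zero → centres glued zero ; (suc zero) → centres glued (suc zero) })
    where
    open _≃⟨_⟩_
    far-from-w : ∀ {z} → dist≤ (sepRadius R) z w ≡ false → ball (sepRadius R) (σ₁ w) z ≡ false
    far-from-w z-far = ¬-not λ b → true≢false (dist≤-sym (sepRadius R) _ _ (ball₁⇒dist≤ (sepRadius R) w _ b)) z-far
    glued : extend (σ₁ w) _ ≃⟨ R ⟩ extend (σ₁ w) _
    glued = Glue.glued R (≃-refl (σ₁ w)) u≃x (far-from-w u-far) (far-from-w x-far)

  near-twins : (U : Fin N → Bool) → ∀ u x → σ₁ u ≃⟨ R ⟩ σ₁ x → NearTwinIn (twinBound D R) (μGraph τ S) U u x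
  near-twins U u x u≃x = begin
    countFin N (λ w → U w ∧ (μ-adj u w xor μ-adj x w))
      ≤⟨ countFin-mono N differs⇒near ⟩
    countFin N (λ w → dist≤ (sepRadius R) u w ∨ dist≤ (sepRadius R) x w)
      ≤⟨ countFin-∨ N _ _ ⟩
    countFin N (dist≤ (sepRadius R) u) + countFin N (dist≤ (sepRadius R) x)
      ≤⟨ +-mono-≤ (ball-size D deg (sepRadius R) u) (ball-size D deg (sepRadius R) x) ⟩
    twinBound D R ∎
    where
    open ≤-Reasoning
    μ-adj : Fin N → Fin N → Bool
    μ-adj a b = eval S (μ τ) (σ₂ a b)
    differs⇒near : ∀ w → U w ∧ (μ-adj u w xor μ-adj x w) ≡ true →
      dist≤ (sepRadius R) u w ∨ dist≤ (sepRadius R) x w ≡ true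
    differs⇒near w differs = ¬-not λ far → true≢false (∧-conicalʳ _ _ differs)
      (trans (cong (_xor μ-adj x w) (far-agree u≃x w (∨-conicalˡ (dist≤ (sepRadius R) u w) _ far)
                                                     (∨-conicalʳ (dist≤ (sepRadius R) u w) _ far)))
             (xor-same (μ-adj x w)))

  module _ (U : Fin N → Bool) where

    Candidate : Vector Bool L → Set
    Candidate h = ∃[ x ] (U x ≡ true × code x ≗ h)

    candidate? : ∀ h → Dec (Candidate h)
    candidate? h = any? λ x → (U x Bool.≟ true) ×-dec all? (λ k → code x k Bool.≟ h k)

    candidates : List (∃[ h ] Candidate h)
    candidates = mapMaybe (λ h → Maybe.map (h ,_) (dec⇒maybe (candidate? h))) (allVectors L)

    representatives : List (Fin N)
    representatives = map (proj₁ ∘ proj₂) candidates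

    length-representatives : length representatives ≤ 2 ^ L
    length-representatives = begin
      length representatives ≡⟨ length-map (proj₁ ∘ proj₂) candidates ⟩
      length candidates      ≤⟨ length-mapMaybe _ (allVectors L) ⟩
      length (allVectors L)  ≡⟨ length-allVectors L ⟩
      2 ^ L                  ∎
      where open ≤-Reasoning

    represented : ∀ u → U u ≡ true → Any (NearTwinIn (twinBound D R) (μGraph τ S) U u) representatives
    represented u Uu = Anyₚ.map⁺ (Anyₚ.mapMaybe⁺ _ _ (Anyₚ.map⁺
      (Any.map (λ {h} u≗h → twin-candidate u≗h (candidate? h)) (allVectors-complete L (code u)))))
      where
      twin-candidate : ∀ {h} → code u ≗ h → (c? : Dec (Candidate h)) →
        MAny.Any (NearTwinIn (twinBound D R) (μGraph τ S) U u ∘ proj₁ ∘ proj₂) (Maybe.map (h ,_) (dec⇒maybe c?))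
      twin-candidate u≗h (yes (x , _ , x≗h)) =
        MAny.just (near-twins U u x (code-≗⇒≃ u x λ k → trans (u≗h k) (≡-sym (x≗h k))))
      twin-candidate u≗h (no no-candidate) = ⊥-elim (no-candidate (u , Uu , u≗h))

    near-covered : NearCoveredIn (twinBound D R) (2 ^ L) (μGraph τ S) U
    near-covered = representatives , length-representatives
                 , Allₚ.map⁺ (All.universal (proj₁ ∘ proj₂ ∘ proj₂) candidates) , represented

theorem16 : (d : ℕ) (τ : Transduction) →
    ∃[ ℓ ] ∃[ q ] (∀ (G : Graph) → MaxDegree≤ d G → AllOutputsNearCovered ℓ q τ G)
theorem16 d τ = twinBound D R , 2 ^ codeLength m p (ballBound D R) , covered
  where
  m p D R : ℕ
  m = copies τ
  p = params τ
  D = copyDegree m d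
  R = radius (μ τ)
  covered : ∀ G → MaxDegree≤ d G → AllOutputsNearCovered (twinBound D R) (2 ^ codeLength m p (ballBound D R)) τ G
  covered G deg ps _ =
    NearCover.near-covered τ (copyExpand m p G ps) D (copyExpand-degree m p d G deg ps) _
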